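{- Let $n_1,n_2\ge 3$ and $1\le r_j\le\lfloor n_j/2\rfloor$ for $j=1,2$. The consecutive circulants $\operatorname{Circ}(n_1,\{1,\dots,r_1\})$ and $\operatorname{Circ}(n_2,\{1,\dots,r_2\})$ have the same distance spectrum (and hence the same distance Laplacian spectrum) if and only if $n_1=n_2$ and $r_1=r_2$.
   Context: For $n\ge3$ and $S\subseteq\mathbb Z_n\setminus\{0\}$, the circulant graph $\operatorname{Circ}(n,S)$ has vertex set $\mathbb Z_n$ and edges $ij$ whenever $i-j$ or $j-i$ lies in $S$. For a connected graph with vertices $w_1,\dots,w_n$, the distance matrix $\mathcal D(G)$ has $(i,j)$-entry equal to the shortest-path distance $d(w_i,w_j)$; $t(v)=\sum_w d(v,w)$; and the distance Laplacian is $\mathcal D^L(G)=\operatorname{diag}(t(w_1),\dots,t(w_n))-\mathcal D(G)$. The distance (resp. distance Laplacian) spectrum is the multiset of eigenvalues of $\mathcal D(G)$ (resp. $\mathcal D^L(G)$). -}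

module Defs where

open import Data.Bool using (Bool; true; false; if_then_else_; _∨_; _∧_)
open import Data.Nat as ℕ using (ℕ; zero; suc; _≤ᵇ_; _%_; _∸_)
open import Data.Integer as ℤ using (ℤ; +_; 0ℤ; 1ℤ)
open import Data.Fin using (Fin; toℕ; punchIn; _≟_) renaming (zero to fzero; suc to fsuc)
open import Data.List using (List; map; foldr; allFin; upTo)
open import Data.Bool.ListAction using (any)
open import Relation.Nullary.Decidable using (isYes)
open import Relation.Binary.PropositionalEquality using (_≡_)

-- (i - j) mod n, as an element of ℤ_n
diffMod : (n : ℕ) → Fin n → Fin n → ℕ
diffMod n i j = (toℕ i ℕ.+ (n ∸ toℕ j)) ℕ.% (suc (n ∸ 1))

-- S ⊆ ℤ_n \ {0} given by its membership test on residues 0..n-1.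
-- Adjacency of Circ(n,S): i ~ j iff i - j ∈ S or j - i ∈ S.
circAdj : (n : ℕ) → (ℕ → Bool) → Fin n → Fin n → Bool
circAdj n S i j = S (diffMod n i j) ∨ S (diffMod n j i)

consecutive : ℕ → ℕ → Bool
consecutive r k = (1 ≤ᵇ k) ∧ (k ≤ᵇ r)

anyFin : ∀ {n} → (Fin n → Bool) → Bool
anyFin {n} p = any p (allFin n)

reach : ∀ {n} → (Fin n → Fin n → Bool) → ℕ → Fin n → Fin n → Bool
reach adj zero    i j = isYes (i ≟ j)
reach adj (suc k) i j = reach adj k i j ∨ anyFin (λ m → reach adj k i m ∧ adj m j)

leastFrom : (ℕ → Bool) → ℕ → ℕ → ℕ
leastFrom f start zero = start
leastFrom f start (suc fuel) = if f start then start else leastFrom f (suc start) fuel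

-- d(i,j) = least k with a walk of length ≤ k from i to j
-- (in a connected graph on n vertices some k < n works)
dist : ∀ {n} → (Fin n → Fin n → Bool) → Fin n → Fin n → ℕ
dist {n} adj i j = leastFrom (λ k → reach adj k i j) 0 n

Mat : ℕ → Set
Mat n = Fin n → Fin n → ℤ

sumFin : ∀ {A : Set} {n} → (A → A → A) → A → (Fin n → A) → A
sumFin {n = n} _⊕_ e f = foldr (λ x acc → f x ⊕ acc) e (allFin n)

distMat : ∀ {n} → (Fin n → Fin n → Bool) → Mat n
distMat adj i j = + dist adj i j

transmission : ∀ {n} → (Fin n → Fin n → Bool) → Fin n → ℤ
transmission adj v = sumFin ℤ._+_ 0ℤ (λ w → distMat adj v w)

distLapMat : ∀ {n} → (Fin n → Fin n → Bool) → Mat n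
distLapMat adj i j =
  (if isYes (i ≟ j) then transmission adj i else 0ℤ) ℤ.- distMat adj i j

DCirc : (n r : ℕ) → Mat n
DCirc n r = distMat (circAdj n (consecutive r))

DLCirc : (n r : ℕ) → Mat n
DLCirc n r = distLapMat (circAdj n (consecutive r))

Poly : Set
Poly = ℕ → ℤ

pconst : ℤ → Poly
pconst c zero    = c
pconst c (suc _) = 0ℤ

pX : Poly
pX (suc zero) = 1ℤ
pX _          = 0ℤ

_+P_ : Poly → Poly → Poly
(p +P q) k = p k ℤ.+ q k

_-P_ : Poly → Poly → Poly
(p -P q) k = p k ℤ.- q k

_*P_ : Poly → Poly → Poly
(p *P q) k = foldr ℤ._+_ 0ℤ (map (λ i → p i ℤ.* q (k ∸ i)) (upTo (suc k)))

alt : ℕ → ℤ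
alt zero    = 1ℤ
alt (suc k) = ℤ.- alt k

det : ∀ n → (Fin n → Fin n → Poly) → Poly
det zero    A = pconst 1ℤ
det (suc n) A = sumFin _+P_ (pconst 0ℤ) (λ j →
  (pconst (alt (toℕ j)) *P A fzero j) *P det n (λ a b → A (fsuc a) (punchIn j b)))

charPoly : ∀ {n} → Mat n → Poly
charPoly {n} M = det n (λ i j → (if isYes (i ≟ j) then pX else pconst 0ℤ) -P pconst (M i j))

-- Same spectrum (multiset of eigenvalues, with algebraic multiplicity)
-- = same characteristic polynomial (coefficientwise).
SameSpectrum : ∀ {n m} → Mat n → Mat m → Set
SameSpectrum A B = ∀ k → charPoly A k ≡ charPoly B k

-- Both spectra determine the characteristic polynomial, hence n as its degree. With y = 1/x, the
-- coefficients of xⁿ, xⁿ⁻¹, xⁿ⁻² in det(xI − M) are those of 1, y, y² in det(I − yM), which are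
-- computed in ℤ[y]/(y³) by expanding along the first row: 1, −tr M and the sum of the principal
-- 2 × 2 minors of −M. For the distance Laplacian the second one is minus the sum of all distances;
-- for the distance matrix, whose diagonal vanishes, the third one is −Σ_{i<j} d(i,j)². Both sums
-- strictly decrease as r grows up to n/2: more chords never lengthen a path, and going from radius t
-- to r > t brings the vertex t + 1 from distance at least 2 to distance 1 from vertex 0.

module Submission where

open import Defs
open import Data.Bool using (Bool; true; false; if_then_else_; T; _∧_)
open import Data.Bool.Properties using (T-∨; T-∧)
open import Data.Empty using (⊥-elim)
open import Data.Fin using (Fin; toℕ; fromℕ<; punchIn; _≟_) renaming (zero to fzero; suc to fsuc)
open import Data.Fin.Properties using (punchInᵢ≢i; punchIn-injective; toℕ-fromℕ<)
open import Data.Integer as ℤ using (ℤ; +_; 0ℤ; 1ℤ; -1ℤ; -_)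
import Data.Integer.Properties as ℤₚ
open import Data.Integer.Tactic.RingSolver using (solve)
open import Data.List using ([]; _∷_; foldr; map; tabulate; allFin; applyUpTo)
open import Data.List.Properties using (foldr-cong; foldr-fusion; foldr-map; map-tabulate)
open import Data.List.Membership.Propositional using (lose)
open import Data.List.Membership.Propositional.Properties using (∈-allFin)
open import Data.List.Relation.Unary.Any as Any using (satisfied)
open import Data.List.Relation.Unary.Any.Properties using (any⁺; any⁻)
open import Data.Nat as ℕ using (ℕ; zero; suc; _≤_; _<_; z≤n; s≤s; _∸_; _/_; _%_)
import Data.Nat.Properties as ℕₚ
open import Data.Nat.DivMod using ([m+n]%n≡m%n; m<n⇒m%n≡m; m/n*n≤m)
open import Data.Product using (_×_; _,_; proj₂)
open import Data.Sum as Sum using (_⊎_; inj₁; inj₂; [_,_])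
open import Function using (id; _∘_)
open import Function.Bundles using (_⇔_; mk⇔; Equivalence)
open import Relation.Binary.Definitions using (tri<; tri≈; tri>)
open import Relation.Binary.PropositionalEquality
  using (_≡_; _≢_; refl; sym; trans; cong; cong₂; subst; subst₂; ≢-sym; module ≡-Reasoning)
open import Relation.Nullary using (¬_; yes; no; does; contradiction)
open import Relation.Nullary.Decidable using (isYes; T?; toWitness; fromWitness; isYes≗does; dec-true; dec-false)

open ≡-Reasoning

module _ {A : Set} (_⊕_ : A → A → A) (ε : A) where

  sumFin-suc : ∀ {n} (f : Fin (suc n) → A) → sumFin _⊕_ ε f ≡ f fzero ⊕ sumFin _⊕_ ε (f ∘ fsuc)
  sumFin-suc {n} f = cong (f fzero ⊕_) (begin
    foldr step ε (tabulate fsuc)        ≡⟨ cong (foldr step ε) (map-tabulate id fsuc) ⟨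
    foldr step ε (map fsuc (allFin n))  ≡⟨ foldr-map step fsuc ε (allFin n) ⟩
    sumFin _⊕_ ε (f ∘ fsuc)             ∎)
    where
    step : Fin (suc n) → A → A
    step i acc = f i ⊕ acc

  sumFin-cong : ∀ {n} {f g : Fin n → A} → (∀ i → f i ≡ g i) → sumFin _⊕_ ε f ≡ sumFin _⊕_ ε g
  sumFin-cong {n} f≗g = foldr-cong (λ i acc → cong (_⊕ acc) (f≗g i)) refl (allFin n)

sumFin-hom : ∀ {A B : Set} (_⊕_ : A → A → A) (ε : A) (_⊗_ : B → B → B) (ε′ : B) (h : A → B) →
  (∀ x y → h (x ⊕ y) ≡ h x ⊗ h y) → h ε ≡ ε′ →
  ∀ {n} (f : Fin n → A) → h (sumFin _⊕_ ε f) ≡ sumFin _⊗_ ε′ (h ∘ f)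
sumFin-hom _⊕_ ε _⊗_ ε′ h hom hε {n} f = begin
  h (sumFin _⊕_ ε f)                             ≡⟨ foldr-fusion h ε (λ i acc → hom (f i) acc) (allFin n) ⟩
  foldr (λ i acc → h (f i) ⊗ acc) (h ε) (allFin n) ≡⟨ foldr-cong (λ _ _ → refl) hε (allFin n) ⟩
  sumFin _⊗_ ε′ (h ∘ f)                          ∎

Σℤ : ∀ {n} → (Fin n → ℤ) → ℤ
Σℤ = sumFin ℤ._+_ 0ℤ

Σℕ : ∀ {n} → (Fin n → ℕ) → ℕ
Σℕ = sumFin ℕ._+_ 0

Σℤ-zero : ∀ {n} {f : Fin n → ℤ} → (∀ i → f i ≡ 0ℤ) → Σℤ f ≡ 0ℤ
Σℤ-zero {zero}  _   = refl
Σℤ-zero {suc n} {f} f≡0 = trans (sumFin-suc ℤ._+_ 0ℤ f) (cong₂ ℤ._+_ (f≡0 fzero) (Σℤ-zero (f≡0 ∘ fsuc)))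

Σℤ-neg : ∀ {n} (f : Fin n → ℤ) → Σℤ (λ i → - f i) ≡ - Σℤ f
Σℤ-neg f = sym (sumFin-hom ℤ._+_ 0ℤ ℤ._+_ 0ℤ -_ ℤₚ.neg-distrib-+ refl f)

Σℤ-pos : ∀ {n} (f : Fin n → ℕ) → Σℤ (λ i → + f i) ≡ + Σℕ f
Σℤ-pos f = sym (sumFin-hom ℕ._+_ 0 ℤ._+_ 0ℤ +_ ℤₚ.pos-+ refl f)

Σℕ-mono : ∀ {n} {f g : Fin n → ℕ} → (∀ i → f i ≤ g i) → Σℕ f ≤ Σℕ g
Σℕ-mono {zero}  _   = z≤n
Σℕ-mono {suc n} {f} {g} f≤g = subst₂ _≤_ (sym (sumFin-suc ℕ._+_ 0 f)) (sym (sumFin-suc ℕ._+_ 0 g))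
  (ℕₚ.+-mono-≤ (f≤g fzero) (Σℕ-mono (f≤g ∘ fsuc)))

Σℕ-mono-< : ∀ {n} {f g : Fin n → ℕ} → (∀ i → f i ≤ g i) → ∀ k → f k < g k → Σℕ f < Σℕ g
Σℕ-mono-< {suc n} {f} {g} f≤g k fk<gk =
  subst₂ _<_ (sym (sumFin-suc ℕ._+_ 0 f)) (sym (sumFin-suc ℕ._+_ 0 g)) (head+tail k fk<gk)
  where
  head+tail : ∀ k → f k < g k → f fzero ℕ.+ Σℕ (f ∘ fsuc) < g fzero ℕ.+ Σℕ (g ∘ fsuc)
  head+tail fzero    lt = ℕₚ.+-mono-<-≤ lt (Σℕ-mono (f≤g ∘ fsuc))
  head+tail (fsuc k) lt = ℕₚ.+-mono-≤-< (f≤g fzero) (Σℕ-mono-< (f≤g ∘ fsuc) k lt)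

minor : ∀ {X : Set} {m} → (Fin (suc m) → Fin (suc m) → X) → Fin (suc m) → Fin m → Fin m → X
minor A j a b = A (fsuc a) (punchIn j b)

IsLinear : Poly → Set
IsLinear p = ∀ k → p (suc (suc k)) ≡ 0ℤ

sumℤ-applyUpTo-vanishing : ∀ (g : ℕ → ℤ) (f : ℕ → ℕ) k → (∀ i → g (f i) ≡ 0ℤ) →
  foldr ℤ._+_ 0ℤ (map g (applyUpTo f k)) ≡ 0ℤ
sumℤ-applyUpTo-vanishing g f zero    _     = refl
sumℤ-applyUpTo-vanishing g f (suc k) g∘f≡0 =
  cong₂ ℤ._+_ (g∘f≡0 0) (sumℤ-applyUpTo-vanishing g (f ∘ suc) k (g∘f≡0 ∘ suc))

pconst-*P : ∀ c p k → (pconst c *P p) k ≡ c ℤ.* p k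
pconst-*P c p k =
  trans (cong (ℤ._+_ (c ℤ.* p k)) (sumℤ-applyUpTo-vanishing _ suc k (λ _ → refl))) (ℤₚ.+-identityʳ _)

*P-zero : ∀ a p → (a *P p) 0 ≡ a 0 ℤ.* p 0
*P-zero a p = ℤₚ.+-identityʳ _

linear-*P-suc : ∀ a → IsLinear a → ∀ p k → (a *P p) (suc k) ≡ a 0 ℤ.* p (suc k) ℤ.+ a 1 ℤ.* p k
linear-*P-suc a lin p k = cong (ℤ._+_ (a 0 ℤ.* p (suc k))) (trans
  (cong (ℤ._+_ (a 1 ℤ.* p k)) (sumℤ-applyUpTo-vanishing _ (suc ∘ suc) k (λ i → cong (ℤ._* _) (lin i))))
  (ℤₚ.+-identityʳ _))

pconst-*P-linear : ∀ s a → IsLinear a → IsLinear (pconst s *P a)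
pconst-*P-linear s a lin k = trans (pconst-*P s a (suc (suc k))) (trans (cong (s ℤ.*_) (lin k)) (ℤₚ.*-zeroʳ s))

sumP-coefficient : ∀ {n} (f : Fin n → Poly) k → sumFin _+P_ (pconst 0ℤ) f k ≡ Σℤ (λ j → f j k)
sumP-coefficient f k = sumFin-hom _+P_ (pconst 0ℤ) ℤ._+_ 0ℤ (λ p → p k) (λ _ _ → refl) (pconst0-vanishes k) f
  where
  pconst0-vanishes : ∀ k → pconst 0ℤ k ≡ 0ℤ
  pconst0-vanishes zero    = refl
  pconst0-vanishes (suc k) = refl

cofactorTerm : ∀ {n} → (Fin (suc n) → Fin (suc n) → Poly) → Fin (suc n) → Poly
cofactorTerm {n} A j = (pconst (alt (toℕ j)) *P A fzero j) *P det n (minor A j)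

det-degree : ∀ n (A : Fin n → Fin n → Poly) → (∀ i j → IsLinear (A i j)) → ∀ k → n < k → det n A k ≡ 0ℤ
det-degree zero    A lin (suc k) _         = refl
det-degree (suc n) A lin (suc k) (s≤s n<k) =
  trans (sumP-coefficient (cofactorTerm A) (suc k)) (Σℤ-zero term-vanishes)
  where
  term-vanishes : ∀ j → cofactorTerm A j (suc k) ≡ 0ℤ
  term-vanishes j = begin
    cofactorTerm A j (suc k)                  ≡⟨ linear-*P-suc b (pconst-*P-linear s (A fzero j) (lin fzero j)) D k ⟩
    b 0 ℤ.* D (suc k) ℤ.+ b 1 ℤ.* D k          ≡⟨ cong₂ (λ x y → b 0 ℤ.* x ℤ.+ b 1 ℤ.* y)
                                                    (minor-degree (suc k) (ℕₚ.m≤n⇒m≤1+n n<k)) (minor-degree k n<k) ⟩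
    b 0 ℤ.* 0ℤ ℤ.+ b 1 ℤ.* 0ℤ                  ≡⟨ cong₂ ℤ._+_ (ℤₚ.*-zeroʳ (b 0)) (ℤₚ.*-zeroʳ (b 1)) ⟩
    0ℤ                                        ∎
    where
    s = alt (toℕ j)
    b = pconst s *P A fzero j
    D = det n (minor A j)
    minor-degree = det-degree n (minor A j) (λ a c → lin (fsuc a) (punchIn j c))

-- Coefficients of xⁿ p(1/x), for p of degree at most n.
reciprocal : ℕ → Poly → Poly
reciprocal n       p zero    = p n
reciprocal zero    p (suc k) = 0ℤ
reciprocal (suc n) p (suc k) = reciprocal n p k

reciprocal-cong : ∀ {p q} → (∀ k → p k ≡ q k) → ∀ n k → reciprocal n p k ≡ reciprocal n q k
reciprocal-cong p≗q n       zero    = p≗q n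
reciprocal-cong p≗q zero    (suc k) = refl
reciprocal-cong p≗q (suc n) (suc k) = reciprocal-cong p≗q n k

reciprocal-+P : ∀ p q n k → reciprocal n (p +P q) k ≡ reciprocal n p k ℤ.+ reciprocal n q k
reciprocal-+P p q n       zero    = refl
reciprocal-+P p q zero    (suc k) = refl
reciprocal-+P p q (suc n) (suc k) = reciprocal-+P p q n k

reciprocal-pconst0 : ∀ n k → reciprocal n (pconst 0ℤ) k ≡ 0ℤ
reciprocal-pconst0 zero    zero    = refl
reciprocal-pconst0 (suc n) zero    = refl
reciprocal-pconst0 zero    (suc k) = refl
reciprocal-pconst0 (suc n) (suc k) = reciprocal-pconst0 n k

reciprocal-linear-*P : ∀ a → IsLinear a → ∀ p n k →
  reciprocal n (a *P p) k ≡ a 0 ℤ.* reciprocal n p k ℤ.+ a 1 ℤ.* reciprocal n p (suc k)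
reciprocal-linear-*P a lin p zero    zero    =
  trans (*P-zero a p) (sym (trans (cong (ℤ._+_ (a 0 ℤ.* p 0)) (ℤₚ.*-zeroʳ (a 1))) (ℤₚ.+-identityʳ _)))
reciprocal-linear-*P a lin p (suc n) zero    = linear-*P-suc a lin p n
reciprocal-linear-*P a lin p zero    (suc k) = sym (cong₂ ℤ._+_ (ℤₚ.*-zeroʳ (a 0)) (ℤₚ.*-zeroʳ (a 1)))
reciprocal-linear-*P a lin p (suc n) (suc k) = reciprocal-linear-*P a lin p n k

-- Determinants over ℤ[y]/(y³)

record Trunc : Set where
  constructor trunc
  field c₀ c₁ c₂ : ℤ
open Trunc

trunc-cong : ∀ {a₀ a₁ a₂ b₀ b₁ b₂} → a₀ ≡ b₀ → a₁ ≡ b₁ → a₂ ≡ b₂ → trunc a₀ a₁ a₂ ≡ trunc b₀ b₁ b₂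
trunc-cong refl refl refl = refl

infixl 6 _+T_
infixl 7 _*T_ _·T_

_+T_ : Trunc → Trunc → Trunc
x +T y = trunc (c₀ x ℤ.+ c₀ y) (c₁ x ℤ.+ c₁ y) (c₂ x ℤ.+ c₂ y)

_*T_ : Trunc → Trunc → Trunc
x *T y = trunc (c₀ x ℤ.* c₀ y) (c₀ x ℤ.* c₁ y ℤ.+ c₁ x ℤ.* c₀ y)
               (c₀ x ℤ.* c₂ y ℤ.+ c₁ x ℤ.* c₁ y ℤ.+ c₂ x ℤ.* c₀ y)

_·T_ : ℤ → Trunc → Trunc
s ·T x = trunc (s ℤ.* c₀ x) (s ℤ.* c₁ x) (s ℤ.* c₂ x)

0T 1T : Trunc
0T = trunc 0ℤ 0ℤ 0ℤ
1T = trunc 1ℤ 0ℤ 0ℤ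

ΣT : ∀ {n} → (Fin n → Trunc) → Trunc
ΣT = sumFin _+T_ 0T

ΣT-components : ∀ {n} (f : Fin n → Trunc) → ΣT f ≡ trunc (Σℤ (c₀ ∘ f)) (Σℤ (c₁ ∘ f)) (Σℤ (c₂ ∘ f))
ΣT-components f = trunc-cong
  (sumFin-hom _+T_ 0T ℤ._+_ 0ℤ c₀ (λ _ _ → refl) refl f)
  (sumFin-hom _+T_ 0T ℤ._+_ 0ℤ c₁ (λ _ _ → refl) refl f)
  (sumFin-hom _+T_ 0T ℤ._+_ 0ℤ c₂ (λ _ _ → refl) refl f)

detT : ∀ n → (Fin n → Fin n → Trunc) → Trunc
cofactorTermT : ∀ {n} → (Fin (suc n) → Fin (suc n) → Trunc) → Fin (suc n) → Trunc

detT zero    A = 1T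
detT (suc n) A = ΣT (cofactorTermT A)

cofactorTermT {n} A j = (alt (toℕ j) ·T A fzero j) *T detT n (minor A j)

detT-cong : ∀ n {A B : Fin n → Fin n → Trunc} → (∀ i j → A i j ≡ B i j) → detT n A ≡ detT n B
detT-cong zero    A≗B = refl
detT-cong (suc n) A≗B = sumFin-cong _+T_ 0T λ j →
  cong₂ (λ a d → (alt (toℕ j) ·T a) *T d) (A≗B fzero j) (detT-cong n (λ a b → A≗B (fsuc a) (punchIn j b)))

top₃ : ℕ → Poly → Trunc
top₃ n p = trunc (reciprocal n p 0) (reciprocal n p 1) (reciprocal n p 2)

top₃-+P : ∀ n p q → top₃ n (p +P q) ≡ top₃ n p +T top₃ n q
top₃-+P n p q = trunc-cong (reciprocal-+P p q n 0) (reciprocal-+P p q n 1) (reciprocal-+P p q n 2)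

top₃-pconst0 : ∀ n → top₃ n (pconst 0ℤ) ≡ 0T
top₃-pconst0 n = trunc-cong (reciprocal-pconst0 n 0) (reciprocal-pconst0 n 1) (reciprocal-pconst0 n 2)

top₃-pconst-*P : ∀ s a → top₃ 1 (pconst s *P a) ≡ s ·T top₃ 1 a
top₃-pconst-*P s a = trunc-cong (pconst-*P s a 1) (pconst-*P s a 0) (sym (ℤₚ.*-zeroʳ s))

top₃-linear-*P : ∀ a → IsLinear a → ∀ n p → p (suc n) ≡ 0ℤ → top₃ (suc n) (a *P p) ≡ top₃ 1 a *T top₃ n p
top₃-linear-*P a lin n p p₁₊ₙ≡0 = trunc-cong
  (trans (coefficient 0) (trans (cong (ℤ._+ a 1 ℤ.* p n) (trans (cong (a 0 ℤ.*_) p₁₊ₙ≡0) (ℤₚ.*-zeroʳ (a 0))))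
                                (ℤₚ.+-identityˡ _)))
  (trans (coefficient 1) (ℤₚ.+-comm (a 0 ℤ.* p n) _))
  (trans (coefficient 2) (trans (ℤₚ.+-comm (a 0 ℤ.* reciprocal n p 1) _) (sym (ℤₚ.+-identityʳ _))))
  where coefficient = reciprocal-linear-*P a lin p (suc n)

top₃-det : ∀ n (A : Fin n → Fin n → Poly) → (∀ i j → IsLinear (A i j)) →
  top₃ n (det n A) ≡ detT n (λ i j → top₃ 1 (A i j))
top₃-det zero    A lin = refl
top₃-det (suc n) A lin = begin
  top₃ (suc n) (det (suc n) A)
    ≡⟨ sumFin-hom _+P_ (pconst 0ℤ) _+T_ 0T (top₃ (suc n)) (top₃-+P (suc n)) (top₃-pconst0 (suc n)) (cofactorTerm A) ⟩
  ΣT (top₃ (suc n) ∘ cofactorTerm A)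
    ≡⟨ sumFin-cong _+T_ 0T term ⟩
  detT (suc n) (λ i j → top₃ 1 (A i j)) ∎
  where
  term : ∀ j → top₃ (suc n) (cofactorTerm A j)
             ≡ (alt (toℕ j) ·T top₃ 1 (A fzero j)) *T detT n (λ a b → top₃ 1 (minor A j a b))
  term j = begin
    top₃ (suc n) (cofactorTerm A j)
      ≡⟨ top₃-linear-*P (pconst s *P A fzero j) (pconst-*P-linear s (A fzero j) (lin fzero j)) n (det n (minor A j))
           (det-degree n (minor A j) minor-linear (suc n) ℕₚ.≤-refl) ⟩
    top₃ 1 (pconst s *P A fzero j) *T top₃ n (det n (minor A j))
      ≡⟨ cong₂ _*T_ (top₃-pconst-*P s (A fzero j)) (top₃-det n (minor A j) minor-linear) ⟩
    (s ·T top₃ 1 (A fzero j)) *T detT n (λ a b → top₃ 1 (minor A j a b)) ∎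
    where
    s = alt (toℕ j)
    minor-linear = λ a c → lin (fsuc a) (punchIn j c)

δ : ∀ {n} → Fin n → Fin n → ℤ
δ i j = if does (i ≟ j) then 1ℤ else 0ℤ

δ-≢ : ∀ {n} {i j : Fin n} → i ≢ j → δ i j ≡ 0ℤ
δ-≢ {i = i} {j} i≢j = cong (if_then 1ℤ else 0ℤ) (dec-false (i ≟ j) i≢j)

neg-*-neg : ∀ a b → - a ℤ.* - b ≡ a ℤ.* b
neg-*-neg a b = solve (a ∷ b ∷ [])

alt-involutive : ∀ k → alt k ℤ.* alt k ≡ 1ℤ
alt-involutive zero    = refl
alt-involutive (suc k) = trans (neg-*-neg (alt k) (alt k)) (alt-involutive k)

c₀-cofactor-vanishesˡ : ∀ s a d → c₀ a ≡ 0ℤ → c₀ ((s ·T a) *T d) ≡ 0ℤ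
c₀-cofactor-vanishesˡ s a d a₀≡0 = cong (ℤ._* c₀ d) (trans (cong (s ℤ.*_) a₀≡0) (ℤₚ.*-zeroʳ s))

c₀-cofactor-vanishesʳ : ∀ s a d → c₀ d ≡ 0ℤ → c₀ ((s ·T a) *T d) ≡ 0ℤ
c₀-cofactor-vanishesʳ s a d d₀≡0 = trans (cong (s ℤ.* c₀ a ℤ.*_) d₀≡0) (ℤₚ.*-zeroʳ (s ℤ.* c₀ a))

c₁-cofactor : ∀ s a d → c₀ d ≡ 0ℤ → c₁ ((s ·T a) *T d) ≡ s ℤ.* c₀ a ℤ.* c₁ d
c₁-cofactor s a d d₀≡0 = trans
  (cong (ℤ._+_ (s ℤ.* c₀ a ℤ.* c₁ d)) (trans (cong (s ℤ.* c₁ a ℤ.*_) d₀≡0) (ℤₚ.*-zeroʳ (s ℤ.* c₁ a))))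
  (ℤₚ.+-identityʳ _)

c₁-cofactor-vanishes : ∀ s a d → c₀ a ≡ 0ℤ → c₀ d ≡ 0ℤ → c₁ ((s ·T a) *T d) ≡ 0ℤ
c₁-cofactor-vanishes s a d a₀≡0 d₀≡0 =
  trans (c₁-cofactor s a d d₀≡0) (cong (ℤ._* c₁ d) (trans (cong (s ℤ.*_) a₀≡0) (ℤₚ.*-zeroʳ s)))

_≡₀_ : ∀ {n} → (Fin n → Fin n → Trunc) → (Fin n → Fin n → ℤ) → Set
A ≡₀ M = ∀ i j → c₀ (A i j) ≡ M i j

detT-c₀-zeroRow : ∀ {n} (A : Fin n → Fin n → Trunc) (z : Fin n) → (∀ b → c₀ (A z b) ≡ 0ℤ) → c₀ (detT n A) ≡ 0ℤ
detT-c₀-zeroRow {suc n} A z row≡0 =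
  trans (cong c₀ (ΣT-components (cofactorTermT A))) (Σℤ-zero (term-vanishes z row≡0))
  where
  term-vanishes : ∀ z → (∀ b → c₀ (A z b) ≡ 0ℤ) → ∀ j → c₀ (cofactorTermT A j) ≡ 0ℤ
  term-vanishes fzero    row≡0 j = c₀-cofactor-vanishesˡ (alt (toℕ j)) (A fzero j) (detT n (minor A j)) (row≡0 j)
  term-vanishes (fsuc z) row≡0 j =
    c₀-cofactor-vanishesʳ (alt (toℕ j)) (A fzero j) (detT n (minor A j))
      (detT-c₀-zeroRow (minor A j) z (row≡0 ∘ punchIn j))

detT-c₀-unit : ∀ {n} (A : Fin n → Fin n → Trunc) → A ≡₀ δ → c₀ (detT n A) ≡ 1ℤ
detT-c₀-unit {zero}  A _    = refl
detT-c₀-unit {suc n} A A≡δ = begin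
  c₀ (detT (suc n) A)                           ≡⟨ cong c₀ (ΣT-components term) ⟩
  Σℤ (c₀ ∘ term)                                ≡⟨ sumFin-suc ℤ._+_ 0ℤ (c₀ ∘ term) ⟩
  c₀ (term fzero) ℤ.+ Σℤ (c₀ ∘ term ∘ fsuc)     ≡⟨ cong₂ ℤ._+_ diagonal (Σℤ-zero off-diagonal) ⟩
  1ℤ                                            ∎
  where
  term : Fin (suc n) → Trunc
  term = cofactorTermT A
  diagonal : c₀ (term fzero) ≡ 1ℤ
  diagonal = cong₂ (λ a d → 1ℤ ℤ.* a ℤ.* d)
    (A≡δ fzero fzero) (detT-c₀-unit (minor A fzero) (λ a b → A≡δ (fsuc a) (fsuc b)))
  off-diagonal : ∀ j → c₀ (term (fsuc j)) ≡ 0ℤ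
  off-diagonal j =
    c₀-cofactor-vanishesˡ (alt (toℕ (fsuc j))) (A fzero (fsuc j)) (detT n (minor A (fsuc j))) (A≡δ fzero (fsuc j))

identityMinor-zeroRow : ∀ {m} (z : Fin (suc m)) (A : Fin (suc m) → Fin (suc m) → Trunc) →
  A ≡₀ minor δ (fsuc z) → ∀ b → c₀ (A z b) ≡ 0ℤ
identityMinor-zeroRow z A A≡ b = trans (A≡ z b) (δ-≢ (≢-sym (punchInᵢ≢i (fsuc z) b)))

-- Modulo y², only the entry of the zero row lying in the column without a 1 contributes.
detT-c₁-identityMinor : ∀ {m} (z : Fin (suc m)) (A : Fin (suc m) → Fin (suc m) → Trunc) →
  A ≡₀ minor δ (fsuc z) → c₁ (detT (suc m) A) ≡ alt (toℕ z) ℤ.* c₁ (A z fzero)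
detT-c₁-identityMinor {m} fzero A A≡ = begin
  c₁ (detT (suc m) A)                          ≡⟨ cong c₁ (ΣT-components term) ⟩
  Σℤ (c₁ ∘ term)                               ≡⟨ sumFin-suc ℤ._+_ 0ℤ (c₁ ∘ term) ⟩
  c₁ (term fzero) ℤ.+ Σℤ (c₁ ∘ term ∘ fsuc)    ≡⟨ cong₂ ℤ._+_ diagonal (Σℤ-zero off-diagonal) ⟩
  1ℤ ℤ.* c₁ (A fzero fzero) ℤ.+ 0ℤ             ≡⟨ ℤₚ.+-identityʳ _ ⟩
  1ℤ ℤ.* c₁ (A fzero fzero)                    ∎
  where
  term : Fin (suc m) → Trunc
  term = cofactorTermT A
  D = detT m (minor A fzero)
  diagonal : c₁ (term fzero) ≡ 1ℤ ℤ.* c₁ (A fzero fzero)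
  diagonal = begin
    c₁ (term fzero)
      ≡⟨ cong₂ (λ a d → 1ℤ ℤ.* a ℤ.* c₁ D ℤ.+ 1ℤ ℤ.* c₁ (A fzero fzero) ℤ.* d)
           (A≡ fzero fzero) (detT-c₀-unit (minor A fzero) (λ a b → A≡ (fsuc a) (fsuc b))) ⟩
    0ℤ ℤ.+ 1ℤ ℤ.* c₁ (A fzero fzero) ℤ.* 1ℤ    ≡⟨ ℤₚ.+-identityˡ _ ⟩
    1ℤ ℤ.* c₁ (A fzero fzero) ℤ.* 1ℤ           ≡⟨ ℤₚ.*-identityʳ _ ⟩
    1ℤ ℤ.* c₁ (A fzero fzero)                  ∎
  off-diagonal : ∀ j → c₁ (term (fsuc j)) ≡ 0ℤ
  off-diagonal j = c₁-cofactor-vanishes (alt (toℕ (fsuc j))) (A fzero (fsuc j)) (detT m (minor A (fsuc j)))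
    (A≡ fzero (fsuc j)) (detT-c₀-zeroRow (minor A (fsuc j)) j lost-its-one)
    where
    lost-its-one : ∀ b → c₀ (minor A (fsuc j) j b) ≡ 0ℤ
    lost-its-one b = trans (A≡ (fsuc j) (punchIn (fsuc j) b))
      (δ-≢ λ eq → punchInᵢ≢i (fsuc j) b (sym (punchIn-injective (fsuc fzero) (fsuc j) _ eq)))
detT-c₁-identityMinor {suc m} (fsuc z) A A≡ = begin
  c₁ (detT (suc (suc m)) A)                                              ≡⟨ cong c₁ (ΣT-components term) ⟩
  Σℤ (c₁ ∘ term)                                                         ≡⟨ sumFin-suc ℤ._+_ 0ℤ (c₁ ∘ term) ⟩
  c₁ (term fzero) ℤ.+ Σℤ (c₁ ∘ term ∘ fsuc)
    ≡⟨ cong (ℤ._+_ (c₁ (term fzero))) (sumFin-suc ℤ._+_ 0ℤ (c₁ ∘ term ∘ fsuc)) ⟩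
  c₁ (term fzero) ℤ.+ (c₁ (term (fsuc fzero)) ℤ.+ Σℤ (c₁ ∘ term ∘ fsuc ∘ fsuc))
    ≡⟨ cong₂ (λ x y → x ℤ.+ (c₁ (term (fsuc fzero)) ℤ.+ y))
         (off-diagonal fzero (A≡ fzero fzero))
         (Σℤ-zero λ j → off-diagonal (fsuc (fsuc j)) (A≡ fzero (fsuc (fsuc j)))) ⟩
  0ℤ ℤ.+ (c₁ (term (fsuc fzero)) ℤ.+ 0ℤ)
    ≡⟨ trans (ℤₚ.+-identityˡ _) (ℤₚ.+-identityʳ _) ⟩
  c₁ (term (fsuc fzero))
    ≡⟨ c₁-cofactor (alt 1) (A fzero (fsuc fzero)) (detT (suc m) (minor A (fsuc fzero))) (minor-det-c₀ (fsuc fzero)) ⟩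
  alt 1 ℤ.* c₀ (A fzero (fsuc fzero)) ℤ.* c₁ (detT (suc m) (minor A (fsuc fzero)))
    ≡⟨ cong₂ (λ a d → alt 1 ℤ.* a ℤ.* d)
         (A≡ fzero (fsuc fzero)) (detT-c₁-identityMinor z (minor A (fsuc fzero)) shifted) ⟩
  -1ℤ ℤ.* (alt (toℕ z) ℤ.* c₁ (A (fsuc z) fzero))
    ≡⟨ trans (ℤₚ.-1*i≡-i _) (ℤₚ.neg-distribˡ-* (alt (toℕ z)) _) ⟩
  alt (toℕ (fsuc z)) ℤ.* c₁ (A (fsuc z) fzero) ∎
  where
  term : Fin (suc (suc m)) → Trunc
  term = cofactorTermT A
  minor-det-c₀ : ∀ j → c₀ (detT (suc m) (minor A j)) ≡ 0ℤ
  minor-det-c₀ j = detT-c₀-zeroRow (minor A j) z (identityMinor-zeroRow (fsuc z) A A≡ ∘ punchIn j)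
  off-diagonal : ∀ j → c₀ (A fzero j) ≡ 0ℤ → c₁ (term j) ≡ 0ℤ
  off-diagonal j a₀≡0 =
    c₁-cofactor-vanishes (alt (toℕ j)) (A fzero j) (detT (suc m) (minor A j)) a₀≡0 (minor-det-c₀ j)
  shifted : minor A (fsuc fzero) ≡₀ minor δ (fsuc z)
  shifted a fzero    = A≡ (fsuc a) fzero
  shifted a (fsuc b) = A≡ (fsuc a) (fsuc (fsuc b))

I+y : ∀ {n} → (Fin n → Fin n → ℤ) → Fin n → Fin n → Trunc
I+y B i j = trunc (δ i j) (B i j) 0ℤ

trace : ∀ {n} → (Fin n → Fin n → ℤ) → ℤ
trace B = Σℤ (λ i → B i i)

-- The sum of the principal 2 × 2 minors of B, collected along the first row.
e₂ : ∀ n → (Fin n → Fin n → ℤ) → ℤ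
e₂ zero    B = 0ℤ
e₂ (suc n) B = e₂ n (minor B fzero) ℤ.+ B fzero fzero ℤ.* trace (minor B fzero)
               ℤ.- Σℤ (λ j → B fzero (fsuc j) ℤ.* B (fsuc j) fzero)

*T-multiples-of-y : ∀ x y → c₀ x ≡ 0ℤ → c₀ y ≡ 0ℤ → x *T y ≡ trunc 0ℤ 0ℤ (c₁ x ℤ.* c₁ y)
*T-multiples-of-y (trunc _ x₁ x₂) (trunc _ y₁ y₂) refl refl =
  trunc-cong refl (solve (x₁ ∷ y₁ ∷ [])) (solve (x₁ ∷ x₂ ∷ y₁ ∷ y₂ ∷ []))

cofactorTermT-I+y-offDiagonal : ∀ {n} (B : Fin (suc n) → Fin (suc n) → ℤ) (j : Fin n) →
  cofactorTermT (I+y B) (fsuc j) ≡ trunc 0ℤ 0ℤ (- (B fzero (fsuc j) ℤ.* B (fsuc j) fzero))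
cofactorTermT-I+y-offDiagonal {suc n} B j = begin
  cofactorTermT (I+y B) (fsuc j)
    ≡⟨ *T-multiples-of-y (- s ·T I+y B fzero (fsuc j)) D (ℤₚ.*-zeroʳ (- s))
         (detT-c₀-zeroRow (minor (I+y B) (fsuc j)) j (identityMinor-zeroRow j (minor (I+y B) (fsuc j)) shape)) ⟩
  trunc 0ℤ 0ℤ (- s ℤ.* B fzero (fsuc j) ℤ.* c₁ D)
    ≡⟨ cong (λ d → trunc 0ℤ 0ℤ (- s ℤ.* B fzero (fsuc j) ℤ.* d))
         (detT-c₁-identityMinor j (minor (I+y B) (fsuc j)) shape) ⟩
  trunc 0ℤ 0ℤ (- s ℤ.* B fzero (fsuc j) ℤ.* (s ℤ.* B (fsuc j) fzero))
    ≡⟨ cong (trunc 0ℤ 0ℤ) (sign-cancels s (B fzero (fsuc j)) (B (fsuc j) fzero) (alt-involutive (toℕ j))) ⟩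
  trunc 0ℤ 0ℤ (- (B fzero (fsuc j) ℤ.* B (fsuc j) fzero)) ∎
  where
  s = alt (toℕ j)
  D = detT (suc n) (minor (I+y B) (fsuc j))
  shape : minor (I+y B) (fsuc j) ≡₀ minor δ (fsuc j)
  shape _ _ = refl
  sign-cancels : ∀ s a b → s ℤ.* s ≡ 1ℤ → - s ℤ.* a ℤ.* (s ℤ.* b) ≡ - (a ℤ.* b)
  sign-cancels s a b s²≡1 = begin
    - s ℤ.* a ℤ.* (s ℤ.* b)   ≡⟨ solve (s ∷ a ∷ b ∷ []) ⟩
    - (s ℤ.* s ℤ.* (a ℤ.* b)) ≡⟨ cong (λ u → - (u ℤ.* (a ℤ.* b))) s²≡1 ⟩
    - (1ℤ ℤ.* (a ℤ.* b))      ≡⟨ cong -_ (ℤₚ.*-identityˡ _) ⟩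
    - (a ℤ.* b)               ∎

detT-I+y : ∀ n (B : Fin n → Fin n → ℤ) → detT n (I+y B) ≡ trunc 1ℤ (trace B) (e₂ n B)
detT-I+y zero    B = refl
detT-I+y (suc n) B = begin
  detT (suc n) (I+y B)    ≡⟨ sumFin-suc _+T_ 0T term ⟩
  term fzero +T ΣT (term ∘ fsuc)
    ≡⟨ cong₂ _+T_ diagonal (trans (sumFin-cong _+T_ 0T (cofactorTermT-I+y-offDiagonal B))
                                  (ΣT-components (λ j → trunc 0ℤ 0ℤ (- g j)))) ⟩
  trunc 1ℤ (b₀₀ ℤ.+ t) (e ℤ.+ b₀₀ ℤ.* t) +T trunc (Σℤ {n} (λ _ → 0ℤ)) (Σℤ {n} (λ _ → 0ℤ)) (Σℤ (λ j → - g j))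
    ≡⟨ trunc-cong (cong (ℤ._+_ 1ℤ) (Σℤ-zero {n} (λ _ → refl)))
                  (trans (cong (ℤ._+_ (b₀₀ ℤ.+ t)) (Σℤ-zero {n} (λ _ → refl)))
                         (trans (ℤₚ.+-identityʳ _) (sym (sumFin-suc ℤ._+_ 0ℤ (λ i → B i i)))))
                  (cong (ℤ._+_ (e ℤ.+ b₀₀ ℤ.* t)) (Σℤ-neg g)) ⟩
  trunc 1ℤ (trace B) (e₂ (suc n) B) ∎
  where
  term : Fin (suc n) → Trunc
  term = cofactorTermT (I+y B)
  b₀₀ = B fzero fzero
  t = trace (minor B fzero)
  e = e₂ n (minor B fzero)
  g : Fin n → ℤ
  g j = B fzero (fsuc j) ℤ.* B (fsuc j) fzero
  diagonal : term fzero ≡ trunc 1ℤ (b₀₀ ℤ.+ t) (e ℤ.+ b₀₀ ℤ.* t)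
  diagonal = trans (cong ((1ℤ ·T I+y B fzero fzero) *T_) (detT-I+y n (minor B fzero))) (unit-product b₀₀ t e)
    where
    unit-product : ∀ b t e → (1ℤ ·T trunc 1ℤ b 0ℤ) *T trunc 1ℤ t e ≡ trunc 1ℤ (b ℤ.+ t) (e ℤ.+ b ℤ.* t)
    unit-product b t e = trunc-cong refl c₁-equation c₂-equation
      where
      c₁-equation : 1ℤ ℤ.* 1ℤ ℤ.* t ℤ.+ 1ℤ ℤ.* b ℤ.* 1ℤ ≡ b ℤ.+ t
      c₁-equation = solve (b ∷ t ∷ [])
      c₂-equation : 1ℤ ℤ.* 1ℤ ℤ.* e ℤ.+ 1ℤ ℤ.* b ℤ.* t ℤ.+ 1ℤ ℤ.* 0ℤ ℤ.* 1ℤ ≡ e ℤ.+ b ℤ.* t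
      c₂-equation = solve (b ∷ t ∷ e ∷ [])

charMatrix : ∀ {n} → Mat n → Fin n → Fin n → Poly
charMatrix M i j = (if isYes (i ≟ j) then pX else pconst 0ℤ) -P pconst (M i j)

charMatrix-linear : ∀ {n} (M : Mat n) i j → IsLinear (charMatrix M i j)
charMatrix-linear M i j k with isYes (i ≟ j)
... | true  = refl
... | false = refl

top₃-charMatrix : ∀ {n} (M : Mat n) i j → top₃ 1 (charMatrix M i j) ≡ I+y (λ a b → - M a b) i j
top₃-charMatrix M i j with i ≟ j
... | yes _ = trunc-cong refl (ℤₚ.+-identityˡ _) refl
... | no _  = trunc-cong refl (ℤₚ.+-identityˡ _) refl

top₃-charPoly : ∀ {n} (M : Mat n) → top₃ n (charPoly M) ≡ trunc 1ℤ (- trace M) (e₂ n (λ i j → - M i j))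
top₃-charPoly {n} M = begin
  top₃ n (charPoly M)                                       ≡⟨ top₃-det n (charMatrix M) (charMatrix-linear M) ⟩
  detT n (λ i j → top₃ 1 (charMatrix M i j))                ≡⟨ detT-cong n (top₃-charMatrix M) ⟩
  detT n (I+y (λ i j → - M i j))                            ≡⟨ detT-I+y n (λ i j → - M i j) ⟩
  trunc 1ℤ (trace (λ i j → - M i j)) (e₂ n (λ i j → - M i j))
    ≡⟨ cong (λ t → trunc 1ℤ t (e₂ n (λ i j → - M i j))) (Σℤ-neg (λ i → M i i)) ⟩
  trunc 1ℤ (- trace M) (e₂ n (λ i j → - M i j))             ∎

charPoly-leading : ∀ {n} (M : Mat n) → charPoly M n ≡ 1ℤ
charPoly-leading M = cong c₀ (top₃-charPoly M)

charPoly-degree : ∀ {n} (M : Mat n) k → n < k → charPoly M k ≡ 0ℤ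
charPoly-degree {n} M = det-degree n (charMatrix M) (charMatrix-linear M)

charPoly-subleading : ∀ {n} (M : Mat n) → reciprocal n (charPoly M) 1 ≡ - trace M
charPoly-subleading M = cong c₁ (top₃-charPoly M)

charPoly-subsubleading : ∀ {n} (M : Mat n) → reciprocal n (charPoly M) 2 ≡ e₂ n (λ i j → - M i j)
charPoly-subsubleading M = cong c₂ (top₃-charPoly M)

SameSpectrum⇒≡size : ∀ {n m} (A : Mat n) (B : Mat m) → SameSpectrum A B → n ≡ m
SameSpectrum⇒≡size {n} {m} A B same with ℕₚ.<-cmp n m
... | tri< n<m _ _ =
  contradiction (trans (sym (charPoly-degree A m n<m)) (trans (same m) (charPoly-leading B))) λ ()
... | tri≈ _ n≡m _ = n≡m
... | tri> _ _ m<n =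
  contradiction (trans (sym (charPoly-degree B n m<n)) (trans (sym (same n)) (charPoly-leading A))) λ ()

pairSum : ∀ n → (Fin n → Fin n → ℕ) → ℕ
pairSum zero    N = 0
pairSum (suc n) N = Σℕ (λ j → N fzero (fsuc j) ℕ.* N (fsuc j) fzero) ℕ.+ pairSum n (minor N fzero)

pairSum-mono : ∀ n {N N′ : Fin n → Fin n → ℕ} → (∀ i j → N i j ≤ N′ i j) → pairSum n N ≤ pairSum n N′
pairSum-mono zero    _    = z≤n
pairSum-mono (suc n) N≤N′ = ℕₚ.+-mono-≤
  (Σℕ-mono (λ j → ℕₚ.*-mono-≤ (N≤N′ fzero (fsuc j)) (N≤N′ (fsuc j) fzero)))
  (pairSum-mono n (λ a b → N≤N′ (fsuc a) (fsuc b)))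

pairSum-mono-< : ∀ n {N N′ : Fin (suc n) → Fin (suc n) → ℕ} → (∀ i j → N i j ≤ N′ i j) → ∀ j →
  N fzero (fsuc j) ℕ.* N (fsuc j) fzero < N′ fzero (fsuc j) ℕ.* N′ (fsuc j) fzero →
  pairSum (suc n) N < pairSum (suc n) N′
pairSum-mono-< n N≤N′ j lt = ℕₚ.+-mono-<-≤
  (Σℕ-mono-< (λ j → ℕₚ.*-mono-≤ (N≤N′ fzero (fsuc j)) (N≤N′ (fsuc j) fzero)) j lt)
  (pairSum-mono n (λ a b → N≤N′ (fsuc a) (fsuc b)))

e₂-negHollow : ∀ n (N : Fin n → Fin n → ℕ) → (∀ i → N i i ≡ 0) → e₂ n (λ i j → - + N i j) ≡ - + pairSum n N
e₂-negHollow zero    N hollow = refl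
e₂-negHollow (suc n) N hollow = begin
  e₂ (suc n) B
    ≡⟨ cong₂ (λ e b → e ℤ.+ b ℤ.* trace (minor B fzero) ℤ.- Σℤ g)
         (e₂-negHollow n (minor N fzero) (hollow ∘ fsuc)) (cong (-_ ∘ +_) (hollow fzero)) ⟩
  - + q ℤ.+ 0ℤ ℤ.- Σℤ g      ≡⟨ cong (λ x → - + q ℤ.+ 0ℤ ℤ.- x) Σg≡s ⟩
  - + q ℤ.+ 0ℤ ℤ.- + s      ≡⟨ rearrange (+ q) (+ s) ⟩
  - (+ s ℤ.+ + q)           ≡⟨ cong -_ (ℤₚ.pos-+ s q) ⟨
  - + (s ℕ.+ q)             ∎
  where
  B : Fin (suc n) → Fin (suc n) → ℤ
  B i j = - + N i j
  q = pairSum n (minor N fzero)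
  s = Σℕ (λ j → N fzero (fsuc j) ℕ.* N (fsuc j) fzero)
  g : Fin n → ℤ
  g j = B fzero (fsuc j) ℤ.* B (fsuc j) fzero
  Σg≡s : Σℤ g ≡ + s
  Σg≡s = trans (sumFin-cong ℤ._+_ 0ℤ λ j → trans (neg-*-neg (+ N fzero (fsuc j)) (+ N (fsuc j) fzero))
                                                    (sym (ℤₚ.pos-* (N fzero (fsuc j)) (N (fsuc j) fzero))))
               (Σℤ-pos (λ j → N fzero (fsuc j) ℕ.* N (fsuc j) fzero))
  rearrange : ∀ a b → - a ℤ.+ 0ℤ ℤ.- b ≡ - (b ℤ.+ a)
  rearrange a b = solve (a ∷ b ∷ [])

leastFrom-hit : ∀ f s fuel → T (f s) → leastFrom f s (suc fuel) ≡ s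
leastFrom-hit f s fuel fs with f s
... | true = refl

leastFrom-skip : ∀ f s fuel → ¬ T (f s) → leastFrom f s (suc fuel) ≡ leastFrom f (suc s) fuel
leastFrom-skip f s fuel ¬fs with f s
... | true  = ⊥-elim (¬fs _)
... | false = refl

leastFrom-≥ : ∀ f s fuel → s ≤ leastFrom f s fuel
leastFrom-≥ f s zero       = ℕₚ.≤-refl
leastFrom-≥ f s (suc fuel) with f s
... | true  = ℕₚ.≤-refl
... | false = ℕₚ.≤-trans (ℕₚ.n≤1+n s) (leastFrom-≥ f (suc s) fuel)

leastFrom-antitone : ∀ {f g} → (∀ k → T (f k) → T (g k)) → ∀ s fuel → leastFrom g s fuel ≤ leastFrom f s fuel
leastFrom-antitone         f⇒g s zero       = ℕₚ.≤-refl
leastFrom-antitone {f} {g} f⇒g s (suc fuel) with g s in gs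
... | true  = leastFrom-≥ f s (suc fuel)
... | false = ℕₚ.≤-trans (leastFrom-antitone f⇒g (suc s) fuel)
                (ℕₚ.≤-reflexive (sym (leastFrom-skip f s fuel (λ fs → subst T gs (f⇒g s fs)))))

reach-mono : ∀ {n} {adj adj′ : Fin n → Fin n → Bool} → (∀ i j → T (adj i j) → T (adj′ i j)) →
  ∀ k i j → T (reach adj k i j) → T (reach adj′ k i j)
reach-mono sub zero    i j r = r
reach-mono {n} {adj} {adj′} sub (suc k) i j r =
  Equivalence.from T-∨ (Sum.map (reach-mono sub k i j) via-neighbour (Equivalence.to T-∨ r))
  where
  step : ∀ {m} → T (reach adj k i m ∧ adj m j) → T (reach adj′ k i m ∧ adj′ m j)
  step {m} w with Equivalence.to T-∧ w
  ... | r , a = Equivalence.from T-∧ (reach-mono sub k i m r , sub m j a)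
  via-neighbour : T (anyFin (λ m → reach adj k i m ∧ adj m j)) → T (anyFin (λ m → reach adj′ k i m ∧ adj′ m j))
  via-neighbour w = any⁺ _ (Any.map step (any⁻ _ (allFin n) w))

reach₁-adjacent : ∀ {n} (adj : Fin n → Fin n → Bool) i j → T (adj i j) → T (reach adj 1 i j)
reach₁-adjacent adj i j a =
  Equivalence.from T-∨ (inj₂ (any⁺ _ (lose (∈-allFin i) (Equivalence.from T-∧ (fromWitness {a? = i ≟ i} refl , a)))))

reach₁⇒adjacent : ∀ {n} (adj : Fin n → Fin n → Bool) i j → T (reach adj 1 i j) → i ≡ j ⊎ T (adj i j)
reach₁⇒adjacent {n} adj i j r with Equivalence.to T-∨ r
... | inj₁ i≡j = inj₁ (toWitness {a? = i ≟ j} i≡j)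
... | inj₂ w   with satisfied (any⁻ _ (allFin n) w)
...   | m , w′ with Equivalence.to T-∧ w′
...     | i≡m , a with toWitness {a? = i ≟ m} i≡m
...       | refl = inj₂ a

dist-refl : ∀ {n} (adj : Fin (suc n) → Fin (suc n) → Bool) i → dist adj i i ≡ 0
dist-refl {n} adj i = leastFrom-hit (λ k → reach adj k i i) 0 n (fromWitness {a? = i ≟ i} refl)

dist-antitone : ∀ {n} {adj adj′ : Fin n → Fin n → Bool} → (∀ i j → T (adj i j) → T (adj′ i j)) →
  ∀ i j → dist adj′ i j ≤ dist adj i j
dist-antitone {n} sub i j = leastFrom-antitone (λ k → reach-mono sub k i j) 0 n

dist≤1 : ∀ {n} (adj : Fin (suc (suc n)) → Fin (suc (suc n)) → Bool) i j → T (adj i j) → dist adj i j ≤ 1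
dist≤1 {n} adj i j a with T? (reach adj 0 i j)
... | yes r₀ = ℕₚ.≤-trans (ℕₚ.≤-reflexive (leastFrom-hit (λ k → reach adj k i j) 0 (suc n) r₀)) z≤n
... | no ¬r₀ = ℕₚ.≤-reflexive (trans (leastFrom-skip (λ k → reach adj k i j) 0 (suc n) ¬r₀)
                                    (leastFrom-hit (λ k → reach adj k i j) 1 n (reach₁-adjacent adj i j a)))

2≤dist : ∀ {n} (adj : Fin (suc (suc n)) → Fin (suc (suc n)) → Bool) i j → i ≢ j → ¬ T (adj i j) → 2 ≤ dist adj i j
2≤dist {n} adj i j i≢j ¬a = subst (2 ≤_)
  (sym (trans (leastFrom-skip f 0 (suc n) (i≢j ∘ toWitness {a? = i ≟ j}))
              (leastFrom-skip f 1 n ([ i≢j , ¬a ] ∘ reach₁⇒adjacent adj i j))))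
  (leastFrom-≥ f 2 n)
  where
  f = λ k → reach adj k i j

totalDistance : ∀ {n} → (Fin n → Fin n → Bool) → ℕ
totalDistance adj = Σℕ (λ i → Σℕ (λ j → dist adj i j))

trace-distLapMat : ∀ {n} (adj : Fin (suc n) → Fin (suc n) → Bool) → trace (distLapMat adj) ≡ + totalDistance adj
trace-distLapMat adj = trans (sumFin-cong ℤ._+_ 0ℤ diagonal) (Σℤ-pos (λ i → Σℕ (λ j → dist adj i j)))
  where
  diagonal : ∀ i → distLapMat adj i i ≡ + Σℕ (λ j → dist adj i j)
  diagonal i = begin
    distLapMat adj i i
      ≡⟨ cong₂ (λ b d → (if b then transmission adj i else 0ℤ) ℤ.- + d)
           (trans (isYes≗does (i ≟ i)) (dec-true (i ≟ i) refl)) (dist-refl adj i) ⟩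
    transmission adj i ℤ.- 0ℤ   ≡⟨ ℤₚ.+-identityʳ _ ⟩
    transmission adj i          ≡⟨ Σℤ-pos (λ j → dist adj i j) ⟩
    + Σℕ (λ j → dist adj i j)   ∎

e₂-negDistMat : ∀ {n} (adj : Fin (suc n) → Fin (suc n) → Bool) →
  e₂ (suc n) (λ i j → - distMat adj i j) ≡ - + pairSum (suc n) (dist adj)
e₂-negDistMat adj = e₂-negHollow _ (dist adj) (dist-refl adj)

-- Consecutive circulants

consecutive-mono : ∀ {r r′} → r ≤ r′ → ∀ k → T (consecutive r k) → T (consecutive r′ k)
consecutive-mono {r} r≤r′ k c with Equivalence.to T-∧ c
... | 1≤k , k≤r = Equivalence.from T-∧ (1≤k , ℕₚ.≤⇒≤ᵇ (ℕₚ.≤-trans (ℕₚ.≤ᵇ⇒≤ k r k≤r) r≤r′))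

consecutive-∋ : ∀ {r k} → suc k ≤ r → T (consecutive r (suc k))
consecutive-∋ = ℕₚ.≤⇒≤ᵇ

consecutive-∌ : ∀ {r k} → r < k → ¬ T (consecutive r k)
consecutive-∌ {r} {k} r<k c = ℕₚ.<⇒≱ r<k (ℕₚ.≤ᵇ⇒≤ k r (proj₂ (Equivalence.to T-∧ c)))

circAdj-mono : ∀ {n S S′} → (∀ k → T (S k) → T (S′ k)) → ∀ i j → T (circAdj n S i j) → T (circAdj n S′ i j)
circAdj-mono S⊆S′ i j = Equivalence.from T-∨ ∘ Sum.map (S⊆S′ _) (S⊆S′ _) ∘ Equivalence.to T-∨

circAdj-sym : ∀ {n} S i j → T (circAdj n S i j) → T (circAdj n S j i)
circAdj-sym {n} S i j =
  Equivalence.from (T-∨ {S (diffMod n j i)}) ∘ Sum.swap ∘ Equivalence.to (T-∨ {S (diffMod n i j)})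

consecutiveAdj : (n r : ℕ) → Fin n → Fin n → Bool
consecutiveAdj n r = circAdj n (consecutive r)

consecutiveAdj-mono : ∀ {n r r′} → r ≤ r′ → ∀ i j → T (consecutiveAdj n r i j) → T (consecutiveAdj n r′ i j)
consecutiveAdj-mono r≤r′ = circAdj-mono (consecutive-mono r≤r′)

consecutiveDist : (n r : ℕ) → Fin n → Fin n → ℕ
consecutiveDist n r = dist (consecutiveAdj n r)

consecutiveDist-antitone : ∀ {n r r′} → r ≤ r′ → ∀ i j → consecutiveDist n r′ i j ≤ consecutiveDist n r i j
consecutiveDist-antitone r≤r′ = dist-antitone (consecutiveAdj-mono r≤r′)

twice-below-half : ∀ {n′ t r} → t < r → r ≤ suc n′ / 2 → suc t ℕ.+ t ≤ n′
twice-below-half {n′} {t} {r} t<r r≤n/2 = ℕₚ.≤-pred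
  (ℕₚ.≤-trans (ℕₚ.≤-reflexive (cong (suc ∘ suc) t+t≡t*2))
  (ℕₚ.≤-trans (ℕₚ.*-monoˡ-≤ 2 t<r)
  (ℕₚ.≤-trans (ℕₚ.*-monoˡ-≤ 2 r≤n/2) (m/n*n≤m (suc n′) 2))))
  where
  t+t≡t*2 : t ℕ.+ t ≡ t ℕ.* 2
  t+t≡t*2 = trans (cong (t ℕ.+_) (sym (ℕₚ.+-identityʳ t))) (ℕₚ.*-comm 2 t)

-- For t < r ≤ n/2, the vertex v = t + 1 is adjacent to 0 in Circ(n, {1..r}) but not in Circ(n, {1..t}).
module RadiusGap (m : ℕ) {t r : ℕ} (t<r : t < r) (r≤n/2 : r ≤ suc (suc m) / 2) where

  t<n′ : t < suc m
  t<n′ = ℕₚ.≤-trans (ℕₚ.m≤m+n (suc t) t) (twice-below-half {suc m} t<r r≤n/2)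

  j : Fin (suc m)
  j = fromℕ< t<n′

  v : Fin (suc (suc m))
  v = fsuc j

  diffMod-v-0 : diffMod (suc (suc m)) v fzero ≡ suc t
  diffMod-v-0 = begin
    (suc (toℕ j) ℕ.+ suc (suc m)) % suc (suc m)
      ≡⟨ cong (λ x → (suc x ℕ.+ suc (suc m)) % suc (suc m)) (toℕ-fromℕ< t<n′) ⟩
    (suc t ℕ.+ suc (suc m)) % suc (suc m)        ≡⟨ [m+n]%n≡m%n (suc t) (suc (suc m)) ⟩
    suc t % suc (suc m)                          ≡⟨ m<n⇒m%n≡m (s≤s t<n′) ⟩
    suc t                                        ∎

  diffMod-0-v : diffMod (suc (suc m)) fzero v ≡ suc m ∸ t
  diffMod-0-v = begin
    (suc m ∸ toℕ j) % suc (suc m)  ≡⟨ cong (λ x → (suc m ∸ x) % suc (suc m)) (toℕ-fromℕ< t<n′) ⟩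
    (suc m ∸ t) % suc (suc m)      ≡⟨ m<n⇒m%n≡m (s≤s (ℕₚ.m∸n≤m (suc m) t)) ⟩
    suc m ∸ t                      ∎

  adjacent : T (consecutiveAdj (suc (suc m)) r v fzero)
  adjacent = Equivalence.from T-∨ (inj₁ (subst (T ∘ consecutive r) (sym diffMod-v-0) (consecutive-∋ t<r)))

  nonadjacent : ¬ T (consecutiveAdj (suc (suc m)) t v fzero)
  nonadjacent a with Equivalence.to T-∨ a
  ... | inj₁ c = consecutive-∌ (ℕₚ.n<1+n t) (subst (T ∘ consecutive t) diffMod-v-0 c)
  ... | inj₂ c = consecutive-∌ (ℕₚ.m+n≤o⇒m≤o∸n (suc t) (twice-below-half {suc m} t<r r≤n/2))
                               (subst (T ∘ consecutive t) diffMod-0-v c)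

  near-v0 : consecutiveDist (suc (suc m)) r v fzero ≤ 1
  near-v0 = dist≤1 (consecutiveAdj (suc (suc m)) r) v fzero adjacent

  near-0v : consecutiveDist (suc (suc m)) r fzero v ≤ 1
  near-0v = dist≤1 (consecutiveAdj (suc (suc m)) r) fzero v (circAdj-sym (consecutive r) v fzero adjacent)

  far-v0 : 2 ≤ consecutiveDist (suc (suc m)) t v fzero
  far-v0 = 2≤dist (consecutiveAdj (suc (suc m)) t) v fzero (λ ()) nonadjacent

  far-0v : 2 ≤ consecutiveDist (suc (suc m)) t fzero v
  far-0v = 2≤dist (consecutiveAdj (suc (suc m)) t) fzero v (λ ())
    (nonadjacent ∘ circAdj-sym (consecutive t) fzero v)

totalDistance-strict : ∀ {m t r} → t < r → r ≤ suc (suc m) / 2 →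
  totalDistance (consecutiveAdj (suc (suc m)) r) < totalDistance (consecutiveAdj (suc (suc m)) t)
totalDistance-strict {m} t<r r≤n/2 =
  Σℕ-mono-< (λ i → Σℕ-mono (antitone i)) fzero (Σℕ-mono-< (antitone fzero) v (ℕₚ.≤-<-trans near-0v far-0v))
  where
  open RadiusGap m t<r r≤n/2
  antitone = consecutiveDist-antitone (ℕₚ.<⇒≤ t<r)

pairSum-strict : ∀ {m t r} → t < r → r ≤ suc (suc m) / 2 →
  pairSum (suc (suc m)) (consecutiveDist (suc (suc m)) r) < pairSum (suc (suc m)) (consecutiveDist (suc (suc m)) t)
pairSum-strict {m} t<r r≤n/2 = pairSum-mono-< (suc m) (consecutiveDist-antitone (ℕₚ.<⇒≤ t<r)) j
  (ℕₚ.≤-<-trans (ℕₚ.*-mono-≤ near-0v near-v0) (ℕₚ.<-≤-trans (s≤s (s≤s z≤n)) (ℕₚ.*-mono-≤ far-0v far-v0)))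
  where open RadiusGap m t<r r≤n/2

strictlyAntitone⇒injective : ∀ {b} (P : ℕ → ℕ) → (∀ {r r′} → r < r′ → r′ ≤ b → P r′ < P r) →
  ∀ {r₁ r₂} → r₁ ≤ b → r₂ ≤ b → P r₁ ≡ P r₂ → r₁ ≡ r₂
strictlyAntitone⇒injective P antitone {r₁} {r₂} r₁≤b r₂≤b P≡ with ℕₚ.<-cmp r₁ r₂
... | tri< r₁<r₂ _ _ = ⊥-elim (ℕₚ.<-irrefl (sym P≡) (antitone r₁<r₂ r₂≤b))
... | tri≈ _ r₁≡r₂ _ = r₁≡r₂
... | tri> _ _ r₂<r₁ = ⊥-elim (ℕₚ.<-irrefl P≡ (antitone r₂<r₁ r₁≤b))

neg-pos-injective : ∀ {a b} → - + a ≡ - + b → a ≡ b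
neg-pos-injective = ℤₚ.+-injective ∘ ℤₚ.neg-injective

sameSpectrum⇒≡radius : ∀ {n b} k (F : ℕ → Mat n) (P : ℕ → ℕ) →
  (∀ r → reciprocal n (charPoly (F r)) k ≡ - + P r) → (∀ {r r′} → r < r′ → r′ ≤ b → P r′ < P r) →
  ∀ {r₁ r₂} → r₁ ≤ b → r₂ ≤ b → SameSpectrum (F r₁) (F r₂) → r₁ ≡ r₂
sameSpectrum⇒≡radius {n} k F P coefficient antitone r₁≤b r₂≤b same =
  strictlyAntitone⇒injective P antitone r₁≤b r₂≤b (neg-pos-injective (begin
    - + P _                          ≡⟨ coefficient _ ⟨
    reciprocal n (charPoly (F _)) k  ≡⟨ reciprocal-cong same n k ⟩
    reciprocal n (charPoly (F _)) k  ≡⟨ coefficient _ ⟩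
    - + P _                          ∎))

DCirc-radius : ∀ {n r₁ r₂} → 2 ≤ n → r₁ ≤ n / 2 → r₂ ≤ n / 2 → SameSpectrum (DCirc n r₁) (DCirc n r₂) → r₁ ≡ r₂
DCirc-radius {suc (suc m)} (s≤s (s≤s _)) =
  sameSpectrum⇒≡radius 2 (DCirc n) (λ r → pairSum n (consecutiveDist n r))
    (λ r → trans (charPoly-subsubleading (DCirc n r)) (e₂-negDistMat (consecutiveAdj n r)))
    (pairSum-strict {m})
  where n = suc (suc m)

DLCirc-radius : ∀ {n r₁ r₂} → 2 ≤ n → r₁ ≤ n / 2 → r₂ ≤ n / 2 → SameSpectrum (DLCirc n r₁) (DLCirc n r₂) → r₁ ≡ r₂
DLCirc-radius {suc (suc m)} (s≤s (s≤s _)) =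
  sameSpectrum⇒≡radius 1 (DLCirc n) (λ r → totalDistance (consecutiveAdj n r))
    (λ r → trans (charPoly-subleading (DLCirc n r)) (cong -_ (trace-distLapMat (consecutiveAdj n r))))
    (totalDistance-strict {m})
  where n = suc (suc m)

sameSpectrum⇒sameParameters : (F : (n r : ℕ) → Mat n) →
  (∀ {n r₁ r₂} → 2 ≤ n → r₁ ≤ n / 2 → r₂ ≤ n / 2 → SameSpectrum (F n r₁) (F n r₂) → r₁ ≡ r₂) →
  ∀ {n₁ n₂ r₁ r₂} → 2 ≤ n₁ → r₁ ≤ n₁ / 2 → r₂ ≤ n₂ / 2 → SameSpectrum (F n₁ r₁) (F n₂ r₂) → n₁ ≡ n₂ × r₁ ≡ r₂
sameSpectrum⇒sameParameters F radius {n₁} {n₂} {r₁} {r₂} 2≤n₁ r₁≤ r₂≤ same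
  with SameSpectrum⇒≡size (F n₁ r₁) (F n₂ r₂) same
... | refl = refl , radius 2≤n₁ r₁≤ r₂≤ same

corollary4p7 : (n₁ n₂ r₁ r₂ : ℕ) →
    3 ≤ n₁ → 3 ≤ n₂ →
    1 ≤ r₁ → r₁ ≤ n₁ / 2 →
    1 ≤ r₂ → r₂ ≤ n₂ / 2 →
    (SameSpectrum (DCirc n₁ r₁) (DCirc n₂ r₂) ⇔ (n₁ ≡ n₂ × r₁ ≡ r₂))
    × (SameSpectrum (DLCirc n₁ r₁) (DLCirc n₂ r₂) ⇔ (n₁ ≡ n₂ × r₁ ≡ r₂))
corollary4p7 n₁ n₂ r₁ r₂ 3≤n₁ _ _ r₁≤n₁/2 _ r₂≤n₂/2 =
  characterised DCirc DCirc-radius , characterised DLCirc DLCirc-radius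
  where
  characterised : (F : (n r : ℕ) → Mat n) →
    (∀ {n r₁ r₂} → 2 ≤ n → r₁ ≤ n / 2 → r₂ ≤ n / 2 → SameSpectrum (F n r₁) (F n r₂) → r₁ ≡ r₂) →
    SameSpectrum (F n₁ r₁) (F n₂ r₂) ⇔ (n₁ ≡ n₂ × r₁ ≡ r₂)
  characterised F radius = mk⇔
    (sameSpectrum⇒sameParameters F radius (ℕₚ.<⇒≤ 3≤n₁) r₁≤n₁/2 r₂≤n₂/2)
    (λ { (refl , refl) k → refl })
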